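{- For all positive integers $l$, $m$ and $n$, the disjoint union $P_l\cup P_m\cup P_n$ is a $\langle 2,2\rangle$ CCE graph.
   Context: All graphs and digraphs are simple (no loops, no multiple arcs). $P_k$ denotes the path on $k$ vertices ($P_1$ is an isolated vertex). The CCE graph $CCE(D)$ of a digraph $D$ is the graph on $V(D)$ in which distinct $u,v$ are adjacent iff there exist vertices $x,y$ with $(y,u),(y,v),(u,x),(v,x)$ all arcs of $D$. A $\langle 2,2\rangle$ digraph is a digraph in which every vertex has indegree at most $2$ and outdegree at most $2$; a $\langle 2,2\rangle$ CCE graph is a graph isomorphic to the CCE graph of some $\langle 2,2\rangle$ digraph. -}

module Defs where

open import Data.Nat using (ℕ; suc; _+_)
open import Data.Fin using (Fin; toℕ)
open import Data.Sum using (_⊎_; inj₁; inj₂)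
open import Data.Product using (_×_; Σ; ∃; ∃-syntax)
open import Data.Empty using (⊥)
open import Relation.Nullary using (¬_)
open import Relation.Binary.PropositionalEquality using (_≡_)
open import Function.Bundles using (_↔_; Inverse)

-- A (simple) digraph on a finite vertex set Fin k: an irreflexive arc relation.
-- (A relation has no multiple arcs by construction.)
record Digraph (k : ℕ) : Set₁ where
  field
    Arc : Fin k → Fin k → Set
    irr : ∀ {v} → ¬ Arc v v
open Digraph public

Distinct3 : {A : Set} → A → A → A → Set
Distinct3 x y z = ¬ x ≡ y × ¬ x ≡ z × ¬ y ≡ z

OutDeg≤2 : ∀ {k} → Digraph k → Set
OutDeg≤2 D = ∀ v x y z → Distinct3 x y z →
  ¬ (Arc D v x × Arc D v y × Arc D v z)

InDeg≤2 : ∀ {k} → Digraph k → Set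
InDeg≤2 D = ∀ v x y z → Distinct3 x y z →
  ¬ (Arc D x v × Arc D y v × Arc D z v)

Is22 : ∀ {k} → Digraph k → Set
Is22 D = OutDeg≤2 D × InDeg≤2 D

CCEAdj : ∀ {k} → Digraph k → Fin k → Fin k → Set
CCEAdj D u v = ¬ u ≡ v × ∃[ x ] ∃[ y ]
  (Arc D y u × Arc D y v × Arc D u x × Arc D v x)

Isomorphic : {V W : Set} → (V → V → Set) → (W → W → Set) → Set
Isomorphic {V} {W} A B = Σ (V ↔ W) λ f →
  ∀ u v → (A u v → B (Inverse.to f u) (Inverse.to f v))
        × (B (Inverse.to f u) (Inverse.to f v) → A u v)

Is22CCE : {W : Set} → (W → W → Set) → Set₁
Is22CCE B = Σ ℕ λ k → Σ (Digraph k) λ D → Is22 D × Isomorphic (CCEAdj D) B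

PathAdj : (k : ℕ) → Fin k → Fin k → Set
PathAdj k i j = (suc (toℕ i) ≡ toℕ j) ⊎ (suc (toℕ j) ≡ toℕ i)

ThreePathsAdj : (l m n : ℕ) → (Fin l ⊎ Fin m ⊎ Fin n) → (Fin l ⊎ Fin m ⊎ Fin n) → Set
ThreePathsAdj l m n (inj₁ i)        (inj₁ j)        = PathAdj l i j
ThreePathsAdj l m n (inj₂ (inj₁ i)) (inj₂ (inj₁ j)) = PathAdj m i j
ThreePathsAdj l m n (inj₂ (inj₂ i)) (inj₂ (inj₂ j)) = PathAdj n i j
ThreePathsAdj l m n _               _               = ⊥

-- Place P_l, P_m, P_n one after another on the positions 0, …, N − 1 and give every vertex v
-- a target Q v, letting v send arcs to the vertices at positions Q v − 1 and Q v.  If Q is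
-- injective, all in- and outdegrees are at most 2.  Two vertices then have a common
-- in-neighbour only if they sit at consecutive positions k, k + 1 with k + 1 in the image of Q,
-- and also a common out-neighbour exactly when Q (k + 1) is within 1 of Q k.  So the CCE graph
-- is the path on 0, …, N − 1 with the links violating these conditions removed.  Translating
-- each path by a constant makes the conditions hold inside it, and the constants are chosen so
-- that they fail between paths.  Permuting the paths we may assume l ≤ n ≤ m; then one choice
-- of translations works when l < n and another when l = n.

module Submission where

open import Defs
open import Data.Nat using (ℕ; suc; _+_; _∸_; _≤_; _<_; _≥_; z≤n; s≤s; s≤s⁻¹; _<?_)
open import Data.Nat.Properties
open import Data.Fin using (Fin; toℕ; fromℕ<; splitAt; join; _↑ˡ_; _↑ʳ_)
open import Data.Fin.Properties using (toℕ-injective; toℕ<n; toℕ-fromℕ<; toℕ-↑ˡ; toℕ-↑ʳ; splitAt-join; join-splitAt)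
open import Data.Sum using (_⊎_; inj₁; inj₂; map₂)
open import Data.Product using (_×_; ∃-syntax; _,_; proj₁; proj₂)
open import Data.Empty using (⊥; ⊥-elim)
open import Relation.Nullary using (¬_; yes; no)
open import Relation.Binary.PropositionalEquality
open import Function.Base using (_∘_; id)
open import Function.Bundles using (_↔_; Inverse; mk↔ₛ′)
open import Function.Construct.Composition using (_↔-∘_)

InWindow : ℕ → ℕ → Set
InWindow a A = a ≡ A ⊎ suc a ≡ A

inWindow-collide : ∀ {x y z A} → InWindow x A → InWindow y A → InWindow z A →
  x ≡ y ⊎ x ≡ z ⊎ y ≡ z
inWindow-collide (inj₁ p) (inj₁ q) _        = inj₁ (trans p (sym q))
inWindow-collide (inj₂ p) (inj₂ q) _        = inj₁ (suc-injective (trans p (sym q)))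
inWindow-collide (inj₁ p) (inj₂ q) (inj₁ r) = inj₂ (inj₁ (trans p (sym r)))
inWindow-collide (inj₁ p) (inj₂ q) (inj₂ r) = inj₂ (inj₂ (suc-injective (trans q (sym r))))
inWindow-collide (inj₂ p) (inj₁ q) (inj₁ r) = inj₂ (inj₂ (trans q (sym r)))
inWindow-collide (inj₂ p) (inj₁ q) (inj₂ r) = inj₂ (inj₁ (suc-injective (trans p (sym r))))

windows-collide : ∀ {w A B C} → InWindow w A → InWindow w B → InWindow w C →
  A ≡ B ⊎ A ≡ C ⊎ B ≡ C
windows-collide (inj₁ p) (inj₁ q) _        = inj₁ (trans (sym p) q)
windows-collide (inj₂ p) (inj₂ q) _        = inj₁ (trans (sym p) q)
windows-collide (inj₁ p) (inj₂ q) (inj₁ r) = inj₂ (inj₁ (trans (sym p) r))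
windows-collide (inj₁ p) (inj₂ q) (inj₂ r) = inj₂ (inj₂ (trans (sym q) r))
windows-collide (inj₂ p) (inj₁ q) (inj₁ r) = inj₂ (inj₂ (trans (sym q) r))
windows-collide (inj₂ p) (inj₁ q) (inj₂ r) = inj₂ (inj₁ (trans (sym p) r))

inWindow-distinct⇒consecutive : ∀ {a b A} → a ≢ b → InWindow a A → InWindow b A →
  (suc a ≡ b × b ≡ A) ⊎ (suc b ≡ a × a ≡ A)
inWindow-distinct⇒consecutive a≢b (inj₁ p) (inj₁ q) = ⊥-elim (a≢b (trans p (sym q)))
inWindow-distinct⇒consecutive a≢b (inj₂ p) (inj₂ q) = ⊥-elim (a≢b (suc-injective (trans p (sym q))))
inWindow-distinct⇒consecutive a≢b (inj₁ p) (inj₂ q) = inj₂ (trans q (sym p) , p)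
inWindow-distinct⇒consecutive a≢b (inj₂ p) (inj₁ q) = inj₁ (trans p (sym q) , q)

inWindow-bounds : ∀ {a A} → InWindow a A → a ≤ A × A ≤ suc a
inWindow-bounds (inj₁ refl) = ≤-refl , n≤1+n _
inWindow-bounds (inj₂ refl) = n≤1+n _ , ≤-refl

¬InWindow-below : ∀ {a A} → A < a → ¬ InWindow a A
¬InWindow-below A<a w = <⇒≱ A<a (proj₁ (inWindow-bounds w))

¬InWindow-above : ∀ {a A} → suc a < A → ¬ InWindow a A
¬InWindow-above a+1<A w = <⇒≱ a+1<A (proj₂ (inWindow-bounds w))

windows-far : ∀ {a A B} → InWindow a A → InWindow a B → ¬ 2 + A ≤ B
windows-far p q 2+A≤B =
  1+n≰n (≤-trans 2+A≤B (≤-trans (proj₂ (inWindow-bounds q)) (s≤s (proj₁ (inWindow-bounds p)))))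

inWindow-cancelʳ : ∀ x {a A} → InWindow (a + x) (A + x) → InWindow a A
inWindow-cancelʳ x {a} {A} (inj₁ e) = inj₁ (+-cancelʳ-≡ x a A e)
inWindow-cancelʳ x {a} {A} (inj₂ e) = inj₂ (+-cancelʳ-≡ x (suc a) A e)

distinct-images : ∀ {V : Set} {f : V → ℕ} → (∀ {a b} → f a ≡ f b → a ≡ b) →
  ∀ {a b c} → Distinct3 a b c → ¬ (f a ≡ f b ⊎ f a ≡ f c ⊎ f b ≡ f c)
distinct-images f-inj (a≢b , a≢c , b≢c) (inj₁ e)        = a≢b (f-inj e)
distinct-images f-inj (a≢b , a≢c , b≢c) (inj₂ (inj₁ e)) = a≢c (f-inj e)
distinct-images f-inj (a≢b , a≢c , b≢c) (inj₂ (inj₂ e)) = b≢c (f-inj e)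

BrokenPathAdj : (ℕ → Set) → ℕ → ℕ → Set
BrokenPathAdj Break a b = (suc a ≡ b × ¬ Break a) ⊎ (suc b ≡ a × ¬ Break b)

InImage : ℕ → (ℕ → ℕ) → ℕ → Set
InImage N Q v = ∃[ y ] (y < N × Q y ≡ v)

record ShiftLayout (N : ℕ) (Q : ℕ → ℕ) (Break : ℕ → Set) : Set where
  field
    injective   : ∀ a b → a < N → b < N → Q a ≡ Q b → a ≡ b
    no-loop     : ∀ a → a < N → ¬ InWindow a (Q a)
    covered     : ∀ k → suc k < N → ¬ Break k → InImage N Q (suc k)
    shift-suc   : ∀ k → suc k < N → ¬ Break k → Q (suc k) ≡ suc (Q k)
    shift-bound : ∀ k → suc k < N → ¬ Break k → Q k < N
    break       : ∀ k → suc k < N → Break k →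
      ¬ InImage N Q (suc k) ⊎ 2 + Q k ≤ Q (suc k) ⊎ 2 + Q (suc k) ≤ Q k

module ShiftDigraph {N Q Break} (L : ShiftLayout N Q Break) where
  open ShiftLayout L

  digraph : Digraph N
  digraph = record
    { Arc = λ v w → InWindow (toℕ w) (Q (toℕ v))
    ; irr = λ {v} → no-loop (toℕ v) (toℕ<n v)
    }

  is22 : Is22 digraph
  is22 = (λ v x y z d (vx , vy , vz) →
            distinct-images toℕ-injective d (inWindow-collide vx vy vz))
       , (λ v x y z d (xv , yv , zv) →
            distinct-images (λ {a} {b} → Q-injective a b) d (windows-collide xv yv zv))
    where
      Q-injective : ∀ (a b : Fin N) → Q (toℕ a) ≡ Q (toℕ b) → a ≡ b
      Q-injective a b e = toℕ-injective (injective (toℕ a) (toℕ b) (toℕ<n a) (toℕ<n b) e)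

  link⇒cce : ∀ (u v : Fin N) → suc (toℕ u) ≡ toℕ v → ¬ Break (toℕ u) → CCEAdj digraph u v
  link⇒cce u v u+1≡v unbroken = u≢v , x , y , y→u , y→v , u→x , v→x
    where
      k : ℕ
      k = toℕ u
      k+1<N : suc k < N
      k+1<N = subst (_< N) (sym u+1≡v) (toℕ<n v)
      preimage : InImage N Q (suc k)
      preimage = covered k k+1<N unbroken
      y : Fin N
      y = fromℕ< (proj₁ (proj₂ preimage))
      Qy≡k+1 : Q (toℕ y) ≡ suc k
      Qy≡k+1 = trans (cong Q (toℕ-fromℕ< _)) (proj₂ (proj₂ preimage))
      x : Fin N
      x = fromℕ< (shift-bound k k+1<N unbroken)
      x≡Qu : toℕ x ≡ Q k
      x≡Qu = toℕ-fromℕ< _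
      u≢v : ¬ u ≡ v
      u≢v refl = 1+n≢n u+1≡v
      y→u : InWindow k (Q (toℕ y))
      y→u = inj₂ (sym Qy≡k+1)
      y→v : InWindow (toℕ v) (Q (toℕ y))
      y→v = inj₁ (trans (sym u+1≡v) (sym Qy≡k+1))
      u→x : InWindow (toℕ x) (Q k)
      u→x = inj₁ x≡Qu
      v→x : InWindow (toℕ x) (Q (toℕ v))
      v→x = inj₂ (trans (cong suc x≡Qu) (trans (sym (shift-suc k k+1<N unbroken)) (cong Q u+1≡v)))

  common-neighbours⇒unbroken : ∀ k x → suc k < N → InImage N Q (suc k) →
    InWindow x (Q k) → InWindow x (Q (suc k)) → ¬ Break k
  common-neighbours⇒unbroken k x k+1<N k+1∈image k→x k+1→x broken
    with break k k+1<N broken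
  ... | inj₁ k+1∉image    = k+1∉image k+1∈image
  ... | inj₂ (inj₁ apart) = windows-far k→x k+1→x apart
  ... | inj₂ (inj₂ apart) = windows-far k+1→x k→x apart

  cce⇒link : ∀ {u v : Fin N} → CCEAdj digraph u v → BrokenPathAdj Break (toℕ u) (toℕ v)
  cce⇒link {u} {v} (u≢v , x , y , y→u , y→v , u→x , v→x)
    with inWindow-distinct⇒consecutive (λ e → u≢v (toℕ-injective e)) y→u y→v
  ... | inj₁ (u+1≡v , v≡Qy) = inj₁ (u+1≡v , common-neighbours⇒unbroken (toℕ u) (toℕ x)
          (subst (_< N) (sym u+1≡v) (toℕ<n v))
          (toℕ y , toℕ<n y , trans (sym v≡Qy) (sym u+1≡v))
          u→x (subst (λ w → InWindow (toℕ x) (Q w)) (sym u+1≡v) v→x))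
  ... | inj₂ (v+1≡u , u≡Qy) = inj₂ (v+1≡u , common-neighbours⇒unbroken (toℕ v) (toℕ x)
          (subst (_< N) (sym v+1≡u) (toℕ<n u))
          (toℕ y , toℕ<n y , trans (sym u≡Qy) (sym v+1≡u))
          v→x (subst (λ w → InWindow (toℕ x) (Q w)) (sym v+1≡u) u→x))

  cce⇔brokenPath : ∀ u v → (CCEAdj digraph u v → BrokenPathAdj Break (toℕ u) (toℕ v))
                         × (BrokenPathAdj Break (toℕ u) (toℕ v) → CCEAdj digraph u v)
  cce⇔brokenPath u v = cce⇒link , λ
    { (inj₁ (u+1≡v , unbroken)) → link⇒cce u v u+1≡v unbroken
    ; (inj₂ (v+1≡u , unbroken)) → cce-sym (link⇒cce v u v+1≡u unbroken)
    }
    where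
      cce-sym : ∀ {a b} → CCEAdj digraph a b → CCEAdj digraph b a
      cce-sym (a≢b , x , y , y→a , y→b , a→x , b→x) =
        (λ e → a≢b (sym e)) , x , y , y→b , y→a , b→x , a→x

BlockBoundary : ℕ → ℕ → ℕ → Set
BlockBoundary l m k = suc k ≡ l ⊎ suc k ≡ l + m

module ThreePathsLine (l m n : ℕ) where
  Vertex : Set
  Vertex = Fin l ⊎ Fin m ⊎ Fin n

  position : Vertex → ℕ
  position (inj₁ i)        = toℕ i
  position (inj₂ (inj₁ j)) = l + toℕ j
  position (inj₂ (inj₂ c)) = l + (m + toℕ c)

  linear-order : Fin (l + (m + n)) ↔ Vertex
  linear-order = mk↔ₛ′ split glue split-glue glue-split
    where
      split : Fin (l + (m + n)) → Vertex
      split u = map₂ (splitAt m) (splitAt l u)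
      glue : Vertex → Fin (l + (m + n))
      glue s = join l (m + n) (map₂ (join m n) s)
      split-glue : ∀ s → split (glue s) ≡ s
      split-glue (inj₁ i) rewrite splitAt-join l (m + n) (inj₁ i) = refl
      split-glue (inj₂ t) rewrite splitAt-join l (m + n) (inj₂ (join m n t)) =
        cong inj₂ (splitAt-join m n t)
      glue-split : ∀ u → glue (split u) ≡ u
      glue-split u with splitAt l u in eq
      ... | inj₁ i = trans (cong (join l (m + n)) (sym eq)) (join-splitAt l (m + n) u)
      ... | inj₂ t = trans (cong (λ z → join l (m + n) (inj₂ z)) (join-splitAt m n t))
                           (trans (cong (join l (m + n)) (sym eq)) (join-splitAt l (m + n) u))

  toℕ-linear-order : ∀ u → toℕ u ≡ position (Inverse.to linear-order u)
  toℕ-linear-order u = trans (cong toℕ (sym (Inverse.strictlyInverseʳ linear-order u)))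
                             (toℕ-glue (Inverse.to linear-order u))
    where
      toℕ-glue : ∀ s → toℕ (Inverse.from linear-order s) ≡ position s
      toℕ-glue (inj₁ i)        = toℕ-↑ˡ i (m + n)
      toℕ-glue (inj₂ (inj₁ j)) = trans (toℕ-↑ʳ l (j ↑ˡ n)) (cong (l +_) (toℕ-↑ˡ j n))
      toℕ-glue (inj₂ (inj₂ c)) = trans (toℕ-↑ʳ l (m ↑ʳ c)) (cong (l +_) (toℕ-↑ʳ m c))

  Next : Vertex → Vertex → Set
  Next (inj₁ i)        (inj₁ j)        = suc (toℕ i) ≡ toℕ j
  Next (inj₂ (inj₁ i)) (inj₂ (inj₁ j)) = suc (toℕ i) ≡ toℕ j
  Next (inj₂ (inj₂ i)) (inj₂ (inj₂ j)) = suc (toℕ i) ≡ toℕ j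
  Next _               _               = ⊥

  threePaths⇒next : ∀ s t → ThreePathsAdj l m n s t → Next s t ⊎ Next t s
  threePaths⇒next (inj₁ i)        (inj₁ j)        st = st
  threePaths⇒next (inj₂ (inj₁ i)) (inj₂ (inj₁ j)) st = st
  threePaths⇒next (inj₂ (inj₂ i)) (inj₂ (inj₂ j)) st = st

  next⇒threePaths : ∀ s t → Next s t ⊎ Next t s → ThreePathsAdj l m n s t
  next⇒threePaths (inj₁ i)        (inj₁ j)        st = st
  next⇒threePaths (inj₂ (inj₁ i)) (inj₂ (inj₁ j)) st = st
  next⇒threePaths (inj₂ (inj₂ i)) (inj₂ (inj₂ j)) st = st
  next⇒threePaths (inj₁ i)        (inj₂ (inj₁ j)) (inj₁ ())
  next⇒threePaths (inj₁ i)        (inj₂ (inj₁ j)) (inj₂ ())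
  next⇒threePaths (inj₁ i)        (inj₂ (inj₂ j)) (inj₁ ())
  next⇒threePaths (inj₁ i)        (inj₂ (inj₂ j)) (inj₂ ())
  next⇒threePaths (inj₂ (inj₁ i)) (inj₁ j)        (inj₁ ())
  next⇒threePaths (inj₂ (inj₁ i)) (inj₁ j)        (inj₂ ())
  next⇒threePaths (inj₂ (inj₁ i)) (inj₂ (inj₂ j)) (inj₁ ())
  next⇒threePaths (inj₂ (inj₁ i)) (inj₂ (inj₂ j)) (inj₂ ())
  next⇒threePaths (inj₂ (inj₂ i)) (inj₁ j)        (inj₁ ())
  next⇒threePaths (inj₂ (inj₂ i)) (inj₁ j)        (inj₂ ())
  next⇒threePaths (inj₂ (inj₂ i)) (inj₂ (inj₁ j)) (inj₁ ())
  next⇒threePaths (inj₂ (inj₂ i)) (inj₂ (inj₁ j)) (inj₂ ())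

  private
    l≤l+ : ∀ x → l ≤ l + x
    l≤l+ x = m≤m+n l x

    l+m≤l+[m+] : ∀ x → l + m ≤ l + (m + x)
    l+m≤l+[m+] x = +-monoʳ-≤ l (m≤m+n m x)

    no-backward-step : ∀ {a b} → b ≤ a → ¬ suc a ≡ b
    no-backward-step b≤a e = 1+n≰n (≤-trans (≤-reflexive e) b≤a)

  unbroken-link⇒next : ∀ s t → suc (position s) ≡ position t → ¬ BlockBoundary l m (position s) →
    Next s t
  unbroken-link⇒next (inj₁ i) (inj₁ j) e _ = e
  unbroken-link⇒next (inj₁ i) (inj₂ (inj₁ j)) e unbroken =
    unbroken (inj₁ (≤-antisym (toℕ<n i) (subst (l ≤_) (sym e) (l≤l+ (toℕ j)))))
  unbroken-link⇒next (inj₁ i) (inj₂ (inj₂ j)) e unbroken =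
    unbroken (inj₁ (≤-antisym (toℕ<n i) (subst (l ≤_) (sym e) (l≤l+ (m + toℕ j)))))
  unbroken-link⇒next (inj₂ (inj₁ i)) (inj₁ j) e _ =
    no-backward-step (≤-trans (<⇒≤ (toℕ<n j)) (l≤l+ (toℕ i))) e
  unbroken-link⇒next (inj₂ (inj₁ i)) (inj₂ (inj₁ j)) e _ =
    +-cancelˡ-≡ l _ _ (trans (+-suc l (toℕ i)) e)
  unbroken-link⇒next (inj₂ (inj₁ i)) (inj₂ (inj₂ j)) e unbroken =
    unbroken (inj₂ (≤-antisym (subst (_≤ l + m) (+-suc l (toℕ i)) (+-monoʳ-≤ l (toℕ<n i)))
                              (subst (l + m ≤_) (sym e) (l+m≤l+[m+] (toℕ j)))))
  unbroken-link⇒next (inj₂ (inj₂ i)) (inj₁ j) e _ =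
    no-backward-step (≤-trans (<⇒≤ (toℕ<n j)) (l≤l+ (m + toℕ i))) e
  unbroken-link⇒next (inj₂ (inj₂ i)) (inj₂ (inj₁ j)) e _ =
    no-backward-step (≤-trans (+-monoʳ-≤ l (<⇒≤ (toℕ<n j))) (l+m≤l+[m+] (toℕ i))) e
  unbroken-link⇒next (inj₂ (inj₂ i)) (inj₂ (inj₂ j)) e _ =
    +-cancelˡ-≡ m _ _ (trans (+-suc m (toℕ i)) (+-cancelˡ-≡ l _ _ (trans (+-suc l (m + toℕ i)) e)))

  next⇒unbroken-link : ∀ s t → Next s t →
    suc (position s) ≡ position t × ¬ BlockBoundary l m (position s)
  next⇒unbroken-link (inj₁ i) (inj₁ j) e = e , λ
    { (inj₁ p) → <-irrefl (trans (sym e) p) (toℕ<n j)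
    ; (inj₂ p) → <-irrefl (trans (sym e) p) (≤-trans (toℕ<n j) (m≤m+n l m)) }
  next⇒unbroken-link (inj₂ (inj₁ i)) (inj₂ (inj₁ j)) e =
    trans (sym (+-suc l (toℕ i))) (cong (l +_) e) , λ
    { (inj₁ p) → no-backward-step (l≤l+ (toℕ i)) p
    ; (inj₂ p) → <-irrefl (trans (sym e) (+-cancelˡ-≡ l _ _ (trans (+-suc l (toℕ i)) p))) (toℕ<n j) }
  next⇒unbroken-link (inj₂ (inj₂ i)) (inj₂ (inj₂ j)) e =
    trans (sym (+-suc l (m + toℕ i))) (cong (l +_) (trans (sym (+-suc m (toℕ i))) (cong (m +_) e))) , λ
    { (inj₁ p) → no-backward-step (l≤l+ (m + toℕ i)) p
    ; (inj₂ p) → no-backward-step (l+m≤l+[m+] (toℕ i)) p }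

  threePaths⇔brokenPath : ∀ s t →
      (ThreePathsAdj l m n s t → BrokenPathAdj (BlockBoundary l m) (position s) (position t))
    × (BrokenPathAdj (BlockBoundary l m) (position s) (position t) → ThreePathsAdj l m n s t)
  threePaths⇔brokenPath s t = to , from
    where
      to : ThreePathsAdj l m n s t → BrokenPathAdj (BlockBoundary l m) (position s) (position t)
      to st with threePaths⇒next s t st
      ... | inj₁ s→t = inj₁ (next⇒unbroken-link s t s→t)
      ... | inj₂ t→s = inj₂ (next⇒unbroken-link t s t→s)
      from : BrokenPathAdj (BlockBoundary l m) (position s) (position t) → ThreePathsAdj l m n s t
      from (inj₁ (e , unbroken)) = next⇒threePaths s t (inj₁ (unbroken-link⇒next s t e unbroken))
      from (inj₂ (e , unbroken)) = next⇒threePaths s t (inj₂ (unbroken-link⇒next t s e unbroken))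

shiftLayout⇒threePaths : ∀ {l m n Q} → ShiftLayout (l + (m + n)) Q (BlockBoundary l m) →
  Is22CCE (ThreePathsAdj l m n)
shiftLayout⇒threePaths {l} {m} {n} L = l + (m + n) , digraph , is22 , linear-order , adjacency
  where
    open ShiftDigraph L
    open ThreePathsLine l m n
    adjacency : ∀ u v →
        (CCEAdj digraph u v → ThreePathsAdj l m n (Inverse.to linear-order u) (Inverse.to linear-order v))
      × (ThreePathsAdj l m n (Inverse.to linear-order u) (Inverse.to linear-order v) → CCEAdj digraph u v)
    adjacency u v =
        (λ uv → proj₂ (threePaths⇔brokenPath su sv) (subst₂ Broken u≡ v≡ (proj₁ (cce⇔brokenPath u v) uv)))
      , (λ st → proj₂ (cce⇔brokenPath u v) (subst₂ Broken (sym u≡) (sym v≡) (proj₁ (threePaths⇔brokenPath su sv) st)))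
      where
        su sv : Vertex
        su = Inverse.to linear-order u
        sv = Inverse.to linear-order v
        u≡ : toℕ u ≡ position su
        u≡ = toℕ-linear-order u
        v≡ : toℕ v ≡ position sv
        v≡ = toℕ-linear-order v
        Broken : ℕ → ℕ → Set
        Broken = BrokenPathAdj (BlockBoundary l m)

Apart : ℕ → ℕ → ℕ → ℕ → Set
Apart c s c′ s′ = c + s ≤ c′ ⊎ c′ + s′ ≤ c

apart⇒distinct : ∀ {c s c′ s′ i j} → Apart c s c′ s′ → i < s → j < s′ → c + i ≢ c′ + j
apart⇒distinct {c} {s} {c′} {s′} {i} {j} (inj₁ c+s≤c′) i<s _ e =
  <-irrefl e (<-≤-trans (+-monoʳ-< c i<s) (≤-trans c+s≤c′ (m≤m+n c′ j)))
apart⇒distinct {c} {s} {c′} {s′} {i} {j} (inj₂ c′+s′≤c) _ j<s′ e =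
  <-irrefl (sym e) (<-≤-trans (+-monoʳ-< c′ j<s′) (≤-trans c′+s′≤c (m≤m+n c i)))

InSlot : ℕ → ℕ → ℕ → Set
InSlot c s v = c ≤ v × v < c + s

inSlot⇒offset< : ∀ {c s v} → InSlot c s v → v ∸ c < s
inSlot⇒offset< {c} (c≤v , v<c+s) = +-cancelˡ-< c _ _ (subst (_< _) (sym (m+[n∸m]≡n c≤v)) v<c+s)

module BlockShift (l m n cA cB cC : ℕ) where
  N : ℕ
  N = l + (m + n)

  shift : ℕ → ℕ
  shift k with k <? l
  ... | yes _ = cA + k
  ... | no _ with k <? l + m
  ...   | yes _ = cB + (k ∸ l)
  ...   | no _  = cC + (k ∸ (l + m))

  shift-A : ∀ i → i < l → shift i ≡ cA + i
  shift-A i i<l with i <? l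
  ... | yes _   = refl
  ... | no i≮l = ⊥-elim (i≮l i<l)

  shift-B : ∀ j → j < m → shift (l + j) ≡ cB + j
  shift-B j j<m with l + j <? l
  ... | yes l+j<l = ⊥-elim (m+n≮m l j l+j<l)
  ... | no _ with l + j <? l + m
  ...   | yes _       = cong (cB +_) (m+n∸m≡n l j)
  ...   | no l+j≮l+m = ⊥-elim (l+j≮l+m (+-monoʳ-< l j<m))

  shift-C : ∀ c → shift (l + (m + c)) ≡ cC + c
  shift-C c with l + (m + c) <? l
  ... | yes p = ⊥-elim (m+n≮m l (m + c) p)
  ... | no _ with l + (m + c) <? l + m
  ...   | yes p = ⊥-elim (m+n≮m (l + m) c (subst (_< l + m) (sym (+-assoc l m c)) p))
  ...   | no _  = cong (cC +_) (trans (cong (_∸ (l + m)) (sym (+-assoc l m c))) (m+n∸m≡n (l + m) c))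

  data Block (k : ℕ) : Set where
    inA : k < l → Block k
    inB : ∀ j → j < m → k ≡ l + j → Block k
    inC : ∀ c → c < n → k ≡ l + (m + c) → Block k

  block : ∀ k → k < N → Block k
  block k k<N with k <? l
  ... | yes k<l = inA k<l
  ... | no k≮l with k <? l + m
  ...   | yes k<l+m = inB (k ∸ l) (+-cancelˡ-< l _ _ (subst (_< l + m) k≡ k<l+m)) k≡
    where
      k≡ : k ≡ l + (k ∸ l)
      k≡ = sym (m+[n∸m]≡n (≮⇒≥ k≮l))
  ...   | no k≮l+m = inC (k ∸ (l + m))
                       (+-cancelˡ-< (l + m) _ _ (subst₂ _<_ k≡ (sym (+-assoc l m n)) k<N))
                       (trans k≡ (+-assoc l m (k ∸ (l + m))))
    where
      k≡ : k ≡ l + m + (k ∸ (l + m))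
      k≡ = sym (m+[n∸m]≡n (≮⇒≥ k≮l+m))

  injective : Apart cA l cB m → Apart cA l cC n → Apart cB m cC n →
    ∀ a b → a < N → b < N → shift a ≡ shift b → a ≡ b
  injective AB AC BC a b a<N b<N e with block a a<N | block b b<N
  ... | inA p | inA q = +-cancelˡ-≡ cA a b (trans (sym (shift-A a p)) (trans e (shift-A b q)))
  ... | inA p | inB j q refl =
    ⊥-elim (apart⇒distinct AB p q (trans (sym (shift-A a p)) (trans e (shift-B j q))))
  ... | inA p | inC c q refl =
    ⊥-elim (apart⇒distinct AC p q (trans (sym (shift-A a p)) (trans e (shift-C c))))
  ... | inB j p refl | inA q =
    ⊥-elim (apart⇒distinct AB q p (trans (sym (shift-A b q)) (trans (sym e) (shift-B j p))))
  ... | inB j p refl | inB j′ q refl =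
    cong (l +_) (+-cancelˡ-≡ cB j j′ (trans (sym (shift-B j p)) (trans e (shift-B j′ q))))
  ... | inB j p refl | inC c q refl =
    ⊥-elim (apart⇒distinct BC p q (trans (sym (shift-B j p)) (trans e (shift-C c))))
  ... | inC c p refl | inA q =
    ⊥-elim (apart⇒distinct AC q p (trans (sym (shift-A b q)) (trans (sym e) (shift-C c))))
  ... | inC c p refl | inB j q refl =
    ⊥-elim (apart⇒distinct BC q p (trans (sym (shift-B j q)) (trans (sym e) (shift-C c))))
  ... | inC c p refl | inC c′ q refl =
    cong (λ z → l + (m + z)) (+-cancelˡ-≡ cC c c′ (trans (sym (shift-C c)) (trans e (shift-C c′))))

  no-loop : ¬ InWindow 0 cA → ¬ InWindow l cB → ¬ InWindow (l + m) cC →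
    ∀ a → a < N → ¬ InWindow a (shift a)
  no-loop A-ok B-ok C-ok a a<N w with block a a<N
  ... | inA p = A-ok (inWindow-cancelʳ a (subst (InWindow a) (shift-A a p) w))
  ... | inB j p refl = B-ok (inWindow-cancelʳ j (subst (InWindow (l + j)) (shift-B j p) w))
  ... | inC c p refl = C-ok (inWindow-cancelʳ c (subst₂ InWindow (sym (+-assoc l m c)) (shift-C c) w))

  private
    suc-l+[m+c] : ∀ c → suc (l + (m + c)) ≡ l + (m + suc c)
    suc-l+[m+c] c = sym (trans (cong (l +_) (+-suc m c)) (+-suc l (m + c)))

  data Interior (k : ℕ) : Set where
    inA : suc k < l → Interior k
    inB : ∀ j → suc j < m → k ≡ l + j → Interior k
    inC : ∀ c → suc c < n → k ≡ l + (m + c) → Interior k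

  interior : ∀ k → suc k < N → ¬ BlockBoundary l m k → Interior k
  interior k k+1<N unbroken with block k (<-trans (n<1+n k) k+1<N)
  ... | inA p = inA (≤∧≢⇒< p (λ e → unbroken (inj₁ e)))
  ... | inB j p refl =
    inB j (≤∧≢⇒< p (λ e → unbroken (inj₂ (trans (sym (+-suc l j)) (cong (l +_) e))))) refl
  ... | inC c p refl = inC c (+-cancelˡ-< m _ _ (+-cancelˡ-< l _ _ (subst (_< N) (suc-l+[m+c] c) k+1<N))) refl

  shift-suc : ∀ k → suc k < N → ¬ BlockBoundary l m k → shift (suc k) ≡ suc (shift k)
  shift-suc k k+1<N unbroken with interior k k+1<N unbroken
  ... | inA p = begin
    shift (suc k)  ≡⟨ shift-A (suc k) p ⟩
    cA + suc k     ≡⟨ +-suc cA k ⟩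
    suc (cA + k)   ≡⟨ cong suc (shift-A k (<-trans (n<1+n k) p)) ⟨
    suc (shift k)  ∎
    where open ≡-Reasoning
  ... | inB j p refl = begin
    shift (suc (l + j))  ≡⟨ cong shift (+-suc l j) ⟨
    shift (l + suc j)    ≡⟨ shift-B (suc j) p ⟩
    cB + suc j           ≡⟨ +-suc cB j ⟩
    suc (cB + j)         ≡⟨ cong suc (shift-B j (<-trans (n<1+n j) p)) ⟨
    suc (shift (l + j))  ∎
    where open ≡-Reasoning
  ... | inC c p refl = begin
    shift (suc (l + (m + c)))  ≡⟨ cong shift (suc-l+[m+c] c) ⟩
    shift (l + (m + suc c))    ≡⟨ shift-C (suc c) ⟩
    cC + suc c                 ≡⟨ +-suc cC c ⟩
    suc (cC + c)               ≡⟨ cong suc (shift-C c) ⟨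
    suc (shift (l + (m + c)))  ∎
    where open ≡-Reasoning

  private
    fits : ∀ {c s i} → suc i < s → c + s ≤ suc N → c + i < N
    fits {c} {s} {i} i+2≤s c+s≤N+1 = s≤s⁻¹ (begin
      suc (suc (c + i))  ≡⟨ cong suc (+-suc c i) ⟨
      suc (c + suc i)    ≡⟨ +-suc c (suc i) ⟨
      c + suc (suc i)    ≤⟨ +-monoʳ-≤ c i+2≤s ⟩
      c + s              ≤⟨ c+s≤N+1 ⟩
      suc N              ∎)
      where open ≤-Reasoning

  shift-bound : cA + l ≤ suc N → cB + m ≤ suc N → cC + n ≤ suc N →
    ∀ k → suc k < N → ¬ BlockBoundary l m k → shift k < N
  shift-bound A-fits B-fits C-fits k k+1<N unbroken with interior k k+1<N unbroken
  ... | inA p        = subst (_< N) (sym (shift-A k (<-trans (n<1+n k) p))) (fits p A-fits)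
  ... | inB j p refl = subst (_< N) (sym (shift-B j (<-trans (n<1+n j) p))) (fits p B-fits)
  ... | inC c p refl = subst (_< N) (sym (shift-C c)) (fits p C-fits)

  slot-A⊆image : ∀ {v} → InSlot cA l v → InImage N shift v
  slot-A⊆image {v} v∈slot@(cA≤v , _) =
    v ∸ cA , <-≤-trans i<l (m≤m+n l (m + n)) , trans (shift-A _ i<l) (m+[n∸m]≡n cA≤v)
    where
      i<l : v ∸ cA < l
      i<l = inSlot⇒offset< v∈slot

  slot-B⊆image : ∀ {v} → InSlot cB m v → InImage N shift v
  slot-B⊆image {v} v∈slot@(cB≤v , _) =
    l + (v ∸ cB) , +-monoʳ-< l (<-≤-trans j<m (m≤m+n m n)) , trans (shift-B _ j<m) (m+[n∸m]≡n cB≤v)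
    where
      j<m : v ∸ cB < m
      j<m = inSlot⇒offset< v∈slot

  slot-C⊆image : ∀ {v} → InSlot cC n v → InImage N shift v
  slot-C⊆image {v} v∈slot@(cC≤v , _) =
    l + (m + (v ∸ cC)) , +-monoʳ-< l (+-monoʳ-< m c<n) , trans (shift-C _) (m+[n∸m]≡n cC≤v)
    where
      c<n : v ∸ cC < n
      c<n = inSlot⇒offset< v∈slot

  Separated : ℕ → ℕ → ℕ → Set
  Separated k a b = ¬ InImage N shift (suc k) ⊎ 2 + a ≤ b ⊎ 2 + b ≤ a

  separated-at-boundaries : 0 < m →
    (∀ i → suc i ≡ l → Separated i (cA + i) cB) →
    (∀ j → suc j ≡ m → Separated (l + j) (cB + j) cC) →
    ∀ k → suc k < N → BlockBoundary l m k → Separated k (shift k) (shift (suc k))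
  separated-at-boundaries 0<m A-B B-C k k+1<N (inj₁ k+1≡l) =
    subst₂ (Separated k) (sym (shift-A k (≤-reflexive k+1≡l))) (sym shift-k+1) (A-B k k+1≡l)
    where
      shift-k+1 : shift (suc k) ≡ cB
      shift-k+1 = begin
        shift (suc k)  ≡⟨ cong shift (trans k+1≡l (sym (+-identityʳ l))) ⟩
        shift (l + 0)  ≡⟨ shift-B 0 0<m ⟩
        cB + 0         ≡⟨ +-identityʳ cB ⟩
        cB             ∎
        where open ≡-Reasoning
  separated-at-boundaries 0<m A-B B-C k k+1<N (inj₂ k+1≡l+m) with block k (<-trans (n<1+n k) k+1<N)
  ... | inA p = ⊥-elim (<-irrefl refl (<-≤-trans (m<m+n l 0<m) (≤-trans (≤-reflexive (sym k+1≡l+m)) p)))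
  ... | inC c p refl = ⊥-elim (no-backward (sym k+1≡l+m))
    where
      no-backward : l + m ≢ suc (l + (m + c))
      no-backward e = 1+n≰n (≤-trans (≤-reflexive (sym e)) (+-monoʳ-≤ l (m≤m+n m c)))
  ... | inB j p refl = subst₂ (Separated (l + j)) (sym (shift-B j p)) (sym shift-k+1) (B-C j j+1≡m)
    where
      j+1≡m : suc j ≡ m
      j+1≡m = +-cancelˡ-≡ l (suc j) m (trans (+-suc l j) k+1≡l+m)
      shift-k+1 : shift (suc (l + j)) ≡ cC
      shift-k+1 = begin
        shift (suc (l + j))  ≡⟨ cong shift (trans k+1≡l+m (cong (l +_) (sym (+-identityʳ m)))) ⟩
        shift (l + (m + 0))  ≡⟨ shift-C 0 ⟩
        cC + 0               ≡⟨ +-identityʳ cC ⟩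
        cC                   ∎
        where open ≡-Reasoning

  image⊆slots : ∀ {v} → InImage N shift v → InSlot cA l v ⊎ InSlot cB m v ⊎ InSlot cC n v
  image⊆slots (y , y<N , refl) with block y y<N
  ... | inA p        = inj₁ (subst (InSlot cA l) (sym (shift-A y p)) (m≤m+n cA y , +-monoʳ-< cA p))
  ... | inB j p refl = inj₂ (inj₁ (subst (InSlot cB m) (sym (shift-B j p)) (m≤m+n cB j , +-monoʳ-< cB p)))
  ... | inC c p refl = inj₂ (inj₂ (subst (InSlot cC n) (sym (shift-C c)) (m≤m+n cC c , +-monoʳ-< cC p)))

  record Conditions : Set where
    field
      A-B-apart     : Apart cA l cB m
      A-C-apart     : Apart cA l cC n
      B-C-apart     : Apart cB m cC n
      A-no-loop     : ¬ InWindow 0 cA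
      B-no-loop     : ¬ InWindow l cB
      C-no-loop     : ¬ InWindow (l + m) cC
      A-fits        : cA + l ≤ suc N
      B-fits        : cB + m ≤ suc N
      C-fits        : cC + n ≤ suc N
      covered       : ∀ k → suc k < N → ¬ BlockBoundary l m k → InImage N shift (suc k)
      B-nonempty    : 0 < m
      A-B-separated : ∀ i → suc i ≡ l → Separated i (cA + i) cB
      B-C-separated : ∀ j → suc j ≡ m → Separated (l + j) (cB + j) cC

  shiftLayout : Conditions → ShiftLayout N shift (BlockBoundary l m)
  shiftLayout C = record
    { injective   = injective A-B-apart A-C-apart B-C-apart
    ; no-loop     = no-loop A-no-loop B-no-loop C-no-loop
    ; covered     = covered
    ; shift-suc   = shift-suc
    ; shift-bound = shift-bound A-fits B-fits C-fits
    ; break       = separated-at-boundaries B-nonempty A-B-separated B-C-separated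
    }
    where open Conditions C

threePaths-l<n≤m : ∀ {l m n} → 1 ≤ l → l < n → n ≤ m → Is22CCE (ThreePathsAdj l m n)
threePaths-l<n≤m {l} {m} {n} 1≤l l<n n≤m = shiftLayout⇒threePaths (shiftLayout conditions)
  where
    -- The translates of the paths of lengths n, m, l fill [1, N] in this order, so every
    -- position but 0 is hit, while consecutive paths land far apart.
    open BlockShift l m n (suc (m + n)) (suc n) 1

    2≤n : 2 ≤ n
    2≤n = <-≤-trans (s≤s 1≤l) l<n

    2≤m : 2 ≤ m
    2≤m = ≤-trans 2≤n n≤m

    covered : ∀ k → suc k < N → ¬ BlockBoundary l m k → InImage N shift (suc k)
    covered k k+1<N _ with suc k <? suc n
    ... | yes k+1<n+1 = slot-C⊆image (s≤s z≤n , k+1<n+1)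
    ... | no k+1≮n+1 with suc k <? suc n + m
    ...   | yes k+1<n+1+m = slot-B⊆image (≮⇒≥ k+1≮n+1 , k+1<n+1+m)
    ...   | no k+1≮n+1+m = slot-A⊆image
      ( subst (_≤ suc k) (cong suc (+-comm n m)) (≮⇒≥ k+1≮n+1+m)
      , <-≤-trans k+1<N (≤-trans (≤-reflexive (+-comm l (m + n))) (n≤1+n _)) )

    conditions : Conditions
    conditions = record
      { A-B-apart     = inj₂ (≤-reflexive (cong suc (+-comm n m)))
      ; A-C-apart     = inj₂ (s≤s (m≤n+m n m))
      ; B-C-apart     = inj₂ ≤-refl
      ; A-no-loop     = ¬InWindow-above (s≤s (≤-trans (≤-trans (n≤1+n 1) 2≤n) (m≤n+m n m)))
      ; B-no-loop     = ¬InWindow-above (s≤s l<n)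
      ; C-no-loop     = ¬InWindow-below (≤-trans 2≤m (m≤n+m m l))
      ; A-fits        = ≤-reflexive (cong suc (+-comm (m + n) l))
      ; B-fits        = s≤s (≤-trans (≤-reflexive (+-comm n m)) (m≤n+m (m + n) l))
      ; C-fits        = s≤s (≤-trans (m≤n+m n m) (m≤n+m (m + n) l))
      ; covered       = covered
      ; B-nonempty    = <-≤-trans (s≤s z≤n) 2≤m
      ; A-B-separated = λ i _ → inj₂ (inj₂ (s≤s (≤-trans (+-monoˡ-≤ n 2≤m) (m≤m+n (m + n) i))))
      ; B-C-separated = λ j _ → inj₂ (inj₂ (s≤s (≤-trans 2≤n (m≤m+n n j))))
      }

threePaths-n≤m : ∀ {m n} → 1 ≤ n → n ≤ m → Is22CCE (ThreePathsAdj n m n)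
threePaths-n≤m {m} {n} 1≤n n≤m = shiftLayout⇒threePaths (shiftLayout conditions)
  where
    -- The paths are translated onto [m + n + 1, N], [0, m) and [m, m + n).  The last two
    -- are adjacent, but position n + m, where the third path starts, is missed.
    open BlockShift n m n (suc (m + n)) 0 m

    0<m : 0 < m
    0<m = ≤-trans 1≤n n≤m

    covered : ∀ k → suc k < N → ¬ BlockBoundary n m k → InImage N shift (suc k)
    covered k k+1<N unbroken with suc k <? m
    ... | yes k+1<m = slot-B⊆image (z≤n , k+1<m)
    ... | no k+1≮m with suc k <? m + n
    ...   | yes k+1<m+n = slot-C⊆image (≮⇒≥ k+1≮m , k+1<m+n)
    ...   | no k+1≮m+n = slot-A⊆image
      ( ≤∧≢⇒< (≮⇒≥ k+1≮m+n) (λ e → unbroken (inj₂ (trans (sym e) (+-comm m n))))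
      , <-≤-trans k+1<N (≤-trans (≤-reflexive (+-comm n (m + n))) (n≤1+n _)) )

    gap : ¬ InImage N shift (n + m)
    gap n+m∈image with image⊆slots n+m∈image
    ... | inj₁ (m+n<n+m , _)        = 1+n≰n (≤-trans m+n<n+m (≤-reflexive (+-comm n m)))
    ... | inj₂ (inj₁ (_ , n+m<m))   = <⇒≱ n+m<m (m≤n+m m n)
    ... | inj₂ (inj₂ (_ , n+m<m+n)) = <-irrefl (+-comm n m) n+m<m+n

    conditions : Conditions
    conditions = record
      { A-B-apart     = inj₂ (≤-trans (m≤m+n m n) (n≤1+n _))
      ; A-C-apart     = inj₂ (n≤1+n _)
      ; B-C-apart     = inj₁ ≤-refl
      ; A-no-loop     = ¬InWindow-above (s≤s (≤-trans 0<m (m≤m+n m n)))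
      ; B-no-loop     = ¬InWindow-below 1≤n
      ; C-no-loop     = ¬InWindow-below (m<n+m m 1≤n)
      ; A-fits        = ≤-reflexive (cong suc (+-comm (m + n) n))
      ; B-fits        = ≤-trans (m≤m+n m n) (≤-trans (m≤n+m (m + n) n) (n≤1+n _))
      ; C-fits        = ≤-trans (m≤n+m (m + n) n) (n≤1+n _)
      ; covered       = covered
      ; B-nonempty    = 0<m
      ; A-B-separated = λ i _ → inj₂ (inj₂ (s≤s (≤-trans 0<m (≤-trans (m≤m+n m n) (m≤m+n (m + n) i)))))
      ; B-C-separated = λ j j+1≡m →
          inj₁ (gap ∘ subst (InImage N shift) (trans (sym (+-suc n j)) (cong (n +_) j+1≡m)))
      }

Is22CCE-respects-≅ : ∀ {V W : Set} {A : V → V → Set} {B : W → W → Set} →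
  Isomorphic A B → Is22CCE A → Is22CCE B
Is22CCE-respects-≅ (g , g-adj) (k , D , D-22 , f , f-adj) =
  k , D , D-22 , g ↔-∘ f , λ u v →
      (λ uv → proj₁ (g-adj _ _) (proj₁ (f-adj u v) uv))
    , (λ st → proj₂ (f-adj u v) (proj₂ (g-adj _ _) st))

module _ (a b c : ℕ) where
  swap₁₂ : Fin a ⊎ Fin b ⊎ Fin c → Fin b ⊎ Fin a ⊎ Fin c
  swap₁₂ (inj₁ i)        = inj₂ (inj₁ i)
  swap₁₂ (inj₂ (inj₁ j)) = inj₁ j
  swap₁₂ (inj₂ (inj₂ k)) = inj₂ (inj₂ k)

  swap₂₃ : Fin a ⊎ Fin b ⊎ Fin c → Fin a ⊎ Fin c ⊎ Fin b
  swap₂₃ (inj₁ i)        = inj₁ i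
  swap₂₃ (inj₂ (inj₁ j)) = inj₂ (inj₂ j)
  swap₂₃ (inj₂ (inj₂ k)) = inj₂ (inj₁ k)

module _ (a b c : ℕ) where
  threePaths-swap₁₂ : Isomorphic (ThreePathsAdj a b c) (ThreePathsAdj b a c)
  threePaths-swap₁₂ = mk↔ₛ′ (swap₁₂ a b c) (swap₁₂ b a c) involutive involutive , preserves
    where
      involutive : ∀ {x y} (s : Fin x ⊎ Fin y ⊎ Fin c) → swap₁₂ y x c (swap₁₂ x y c s) ≡ s
      involutive (inj₁ _)        = refl
      involutive (inj₂ (inj₁ _)) = refl
      involutive (inj₂ (inj₂ _)) = refl
      preserves : ∀ s t → (ThreePathsAdj a b c s t → ThreePathsAdj b a c (swap₁₂ a b c s) (swap₁₂ a b c t))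
                        × (ThreePathsAdj b a c (swap₁₂ a b c s) (swap₁₂ a b c t) → ThreePathsAdj a b c s t)
      preserves (inj₁ _)        (inj₁ _)        = id , id
      preserves (inj₁ _)        (inj₂ (inj₁ _)) = id , id
      preserves (inj₁ _)        (inj₂ (inj₂ _)) = id , id
      preserves (inj₂ (inj₁ _)) (inj₁ _)        = id , id
      preserves (inj₂ (inj₁ _)) (inj₂ (inj₁ _)) = id , id
      preserves (inj₂ (inj₁ _)) (inj₂ (inj₂ _)) = id , id
      preserves (inj₂ (inj₂ _)) (inj₁ _)        = id , id
      preserves (inj₂ (inj₂ _)) (inj₂ (inj₁ _)) = id , id
      preserves (inj₂ (inj₂ _)) (inj₂ (inj₂ _)) = id , id

  threePaths-swap₂₃ : Isomorphic (ThreePathsAdj a b c) (ThreePathsAdj a c b)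
  threePaths-swap₂₃ = mk↔ₛ′ (swap₂₃ a b c) (swap₂₃ a c b) involutive involutive , preserves
    where
      involutive : ∀ {y z} (s : Fin a ⊎ Fin y ⊎ Fin z) → swap₂₃ a z y (swap₂₃ a y z s) ≡ s
      involutive (inj₁ _)        = refl
      involutive (inj₂ (inj₁ _)) = refl
      involutive (inj₂ (inj₂ _)) = refl
      preserves : ∀ s t → (ThreePathsAdj a b c s t → ThreePathsAdj a c b (swap₂₃ a b c s) (swap₂₃ a b c t))
                        × (ThreePathsAdj a c b (swap₂₃ a b c s) (swap₂₃ a b c t) → ThreePathsAdj a b c s t)
      preserves (inj₁ _)        (inj₁ _)        = id , id
      preserves (inj₁ _)        (inj₂ (inj₁ _)) = id , id
      preserves (inj₁ _)        (inj₂ (inj₂ _)) = id , id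
      preserves (inj₂ (inj₁ _)) (inj₁ _)        = id , id
      preserves (inj₂ (inj₁ _)) (inj₂ (inj₁ _)) = id , id
      preserves (inj₂ (inj₁ _)) (inj₂ (inj₂ _)) = id , id
      preserves (inj₂ (inj₂ _)) (inj₁ _)        = id , id
      preserves (inj₂ (inj₂ _)) (inj₂ (inj₁ _)) = id , id
      preserves (inj₂ (inj₂ _)) (inj₂ (inj₂ _)) = id , id

Is22CCE-swap₁₂ : ∀ {a b c} → Is22CCE (ThreePathsAdj a b c) → Is22CCE (ThreePathsAdj b a c)
Is22CCE-swap₁₂ {a} {b} {c} =
  Is22CCE-respects-≅ {A = ThreePathsAdj a b c} {B = ThreePathsAdj b a c} (threePaths-swap₁₂ a b c)

Is22CCE-swap₂₃ : ∀ {a b c} → Is22CCE (ThreePathsAdj a b c) → Is22CCE (ThreePathsAdj a c b)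
Is22CCE-swap₂₃ {a} {b} {c} =
  Is22CCE-respects-≅ {A = ThreePathsAdj a b c} {B = ThreePathsAdj a c b} (threePaths-swap₂₃ a b c)

symmetric-sorted⇒all : (P : ℕ → ℕ → ℕ → Set₁) →
  (∀ {a b c} → P a b c → P b a c) → (∀ {a b c} → P a b c → P a c b) →
  (∀ {a b c} → 1 ≤ a → a ≤ b → b ≤ c → P a b c) →
  ∀ {a b c} → 1 ≤ a → 1 ≤ b → 1 ≤ c → P a b c
symmetric-sorted⇒all P s₁₂ s₂₃ sorted {a} {b} {c} 1≤a 1≤b 1≤c
  with ≤-total a b | ≤-total b c | ≤-total a c
... | inj₁ a≤b | inj₁ b≤c | _        = sorted 1≤a a≤b b≤c
... | inj₁ a≤b | inj₂ c≤b | inj₁ a≤c = s₂₃ (sorted 1≤a a≤c c≤b)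
... | inj₁ a≤b | inj₂ c≤b | inj₂ c≤a = s₂₃ (s₁₂ (sorted 1≤c c≤a a≤b))
... | inj₂ b≤a | inj₁ b≤c | inj₁ a≤c = s₁₂ (sorted 1≤b b≤a a≤c)
... | inj₂ b≤a | inj₁ b≤c | inj₂ c≤a = s₁₂ (s₂₃ (sorted 1≤b b≤c c≤a))
... | inj₂ b≤a | inj₂ c≤b | _        = s₁₂ (s₂₃ (s₁₂ (sorted 1≤c c≤b b≤a)))

threePaths-sorted : ∀ {a b c} → 1 ≤ a → a ≤ b → b ≤ c → Is22CCE (ThreePathsAdj a b c)
threePaths-sorted {a} {b} {c} 1≤a a≤b b≤c with m≤n⇒m<n∨m≡n a≤b
... | inj₁ a<b  = Is22CCE-swap₂₃ (threePaths-l<n≤m 1≤a a<b b≤c)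
... | inj₂ refl = Is22CCE-swap₂₃ (threePaths-n≤m 1≤a b≤c)

proposition3p7 : (l m n : ℕ) → l ≥ 1 → m ≥ 1 → n ≥ 1 →
    Is22CCE (ThreePathsAdj l m n)
proposition3p7 l m n = symmetric-sorted⇒all (λ a b c → Is22CCE (ThreePathsAdj a b c))
  Is22CCE-swap₁₂ Is22CCE-swap₂₃ threePaths-sorted
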